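{- Let $S$ be a finite set of PLTL-clauses and let $T$ be obtained from $S$ by adding finitely many initial clauses and finitely many step clauses which only involve proposition symbols occurring in $S$. Then the behaviour graph of $T$ is a subgraph of the behaviour graph of $S$.
   Context: A literal is a proposition symbol or its negation. A PLTL-clause has one of the forms $\mathbf{start}\Rightarrow\bigvee_c l_c$ (initial clause), $\bigwedge_a k_a\Rightarrow\bigcirc\bigvee_d l_d$ (step clause), $\bigwedge_b k_b\Rightarrow\Diamond l$ (sometime clause), all $k,l$ literals ($\bigcirc$ = next, $\Diamond$ = sometime, $\mathbf{start}$ true only at the first moment). The literals $l$ on the right of sometime clauses are the eventuality literals. Behaviour graph of a set $S$ of PLTL-clauses: consider the directed graph $G$ whose nodes are all pairs $(V,E)$ with $V$ a valuation of the proposition symbols occurring in $S$ and $E$ a subset of the eventuality literals of $S$. For a node $(V,E)$, let $L$ be the set of propositional clauses obtained as right-hand sides (with $\bigcirc$ removed) of the step clauses of $S$ whose left-hand sides are satisfied by $V$, and let $E'$ be the set of elements of $E$ not satisfied by $V$; for each valuation $V'$ satisfying all clauses in $L$, letting $E''$ be the set of eventuality literals $l$ such that $S$ contains a sometime clause $C\Rightarrow\Diamond l$ with $C$ satisfied by $V'$, there is an edge from $(V,E)$ to $(V',E'\cup E'')$, and these are the only edges from $(V,E)$. A node $(V,E')$ is initial if $V$ satisfies the right-hand sides of all initial clauses of $S$ and $E'$ is the set of eventuality literals of the sometime clauses whose left-hand sides are satisfied by $V$. The behaviour graph of $S$ is the subgraph of $G$ induced by the nodes reachable from the initial nodes, together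 with the designation of its initial nodes. -}

module Defs where

open import Data.Nat using (ℕ; _≡ᵇ_)
open import Data.Bool using (Bool; true; false; not; _∧_; _∨_)
open import Data.List using (List; []; _∷_; _++_; map; concatMap)
open import Data.Bool.ListAction using (any; all)
open import Data.List.Membership.Propositional using (_∈_)
open import Data.Product using (_×_; _,_; uncurry; Σ)
open import Relation.Binary.PropositionalEquality using (_≡_)

Atom : Set
Atom = ℕ

data Lit : Set where
  pos : Atom → Lit
  neg : Atom → Lit

-- PLTL-clauses (in the normal form of the paper).
--   initial ls      :  start ⇒ ⋁ ls
--   step ks ls      :  ⋀ ks ⇒ ○ ⋁ ls
--   sometime ks l   :  ⋀ ks ⇒ ◇ l
data Clause : Set where
  initial  : List Lit → Clause
  step     : List Lit → List Lit → Clause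
  sometime : List Lit → Lit → Clause

-- Finite sets of clauses are represented by lists (only membership matters).
ClauseSet : Set
ClauseSet = List Clause

atomOf : Lit → Atom
atomOf (pos p) = p
atomOf (neg p) = p

atomsLits : List Lit → List Atom
atomsLits = map atomOf

atomsClause : Clause → List Atom
atomsClause (initial ls)    = atomsLits ls
atomsClause (step ks ls)    = atomsLits ks ++ atomsLits ls
atomsClause (sometime ks l) = atomsLits ks ++ (atomOf l ∷ [])

atoms : ClauseSet → List Atom
atoms = concatMap atomsClause

eqLit : Lit → Lit → Bool
eqLit (pos p) (pos q) = p ≡ᵇ q
eqLit (neg p) (neg q) = p ≡ᵇ q
eqLit _       _       = false

-- Valuations are total functions Atom → Bool; a valuation of the symbols
-- occurring in S is represented canonically by one that is false on all
-- other symbols (see Canon below).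
Valuation : Set
Valuation = Atom → Bool

EvSet : Set
EvSet = Lit → Bool

satLit : Valuation → Lit → Bool
satLit V (pos p) = V p
satLit V (neg p) = not (V p)

satConj : Valuation → List Lit → Bool
satConj V ks = all (satLit V) ks

satDisj : Valuation → List Lit → Bool
satDisj V ls = any (satLit V) ls

Canon : ClauseSet → Valuation → Set
Canon S V = ∀ p → V p ≡ true → p ∈ atoms S

IsEvLit : ClauseSet → Lit → Set
IsEvLit S l = Σ (List Lit) (λ ks → sometime ks l ∈ S)

triggers : Valuation → Lit → Clause → Bool
triggers V l (sometime ks l') = eqLit l l' ∧ satConj V ks
triggers V l _                = false

evAt : ClauseSet → Valuation → EvSet
evAt S V l = any (triggers V l) S

Node : Set
Node = Valuation × EvSet

IsNode : ClauseSet → Node → Set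
IsNode S (V , E) = Canon S V × (∀ l → E l ≡ true → IsEvLit S l)

Initial : ClauseSet → Node → Set
Initial S (V , E) =
  Canon S V ×
  (∀ ls → initial ls ∈ S → satDisj V ls ≡ true) ×
  (∀ l → E l ≡ evAt S V l)

Edge : ClauseSet → Node → Node → Set
Edge S (V , E) (V' , F) =
  Canon S V' ×
  (∀ ks ls → step ks ls ∈ S → satConj V ks ≡ true → satDisj V' ls ≡ true) ×
  (∀ l → F l ≡ ((E l ∧ not (satLit V l)) ∨ evAt S V' l))

data Reach (S : ClauseSet) : Node → Set where
  init : ∀ {n} → Initial S n → Reach S n
  next : ∀ {n m} → Reach S n → IsNode S n → Edge S n m → Reach S m

record Graph : Set₁ where
  field
    GNode : Node → Set
    GEdge : Node → Node → Set
    GInit : Node → Set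

BehaviourGraph : ClauseSet → Graph
BehaviourGraph S = record
  { GNode = Reach S
  ; GEdge = λ n m → Reach S n × Reach S m × Edge S n m
  ; GInit = Initial S
  }

record Subgraph (G H : Graph) : Set where
  open Graph
  field
    nodes⊆ : ∀ n → GNode G n → GNode H n
    edges⊆ : ∀ n m → GEdge G n m → GEdge H n m
    inits⊆ : ∀ n → GInit G n → GInit H n

extend : ClauseSet → List (List Lit) → List (List Lit × List Lit) → ClauseSet
extend S is ss = S ++ map initial is ++ map (uncurry step) ss

OnlySymbolsOf : ClauseSet → Clause → Set
OnlySymbolsOf S c = ∀ p → p ∈ atomsClause c → p ∈ atoms S

{-# OPTIONS --safe #-}
-- The added clauses mention no new proposition symbols, so T and S have the
-- same valuations, and they contain no sometime clauses, so T and S assign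
-- the same eventuality sets.  Hence every node of T is a node of S,
-- while the extra initial and step clauses only restrict which nodes are
-- initial and which successors are allowed; reachability in T therefore
-- implies reachability in S.
module Submission where

open import Defs
open import Data.Bool using (Bool; false; _∨_)
open import Data.List using (List; []; _∷_; _++_; map; foldr)
open import Data.List.Properties using (map-++; foldr-++; concatMap-++)
open import Data.List.Relation.Unary.All using (All; []; _∷_; universal)
import Data.List.Relation.Unary.All as All
open import Data.List.Relation.Unary.All.Properties using (++⁺; map⁺)
open import Data.List.Membership.Propositional using (_∈_)
open import Data.List.Membership.Propositional.Properties using (∈-++⁻; ∈-++⁺ˡ)
open import Data.Product using (_×_; _,_; uncurry)
open import Data.Sum using (inj₁; inj₂)
open import Relation.Binary.PropositionalEquality using (_≡_; refl; cong; trans; subst; module ≡-Reasoning)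

data NonSometime : Clause → Set where
  initial : ∀ ls → NonSometime (initial ls)
  step    : ∀ ks ls → NonSometime (step ks ls)

atoms⊆ : ∀ S {R p} → All (OnlySymbolsOf S) R → p ∈ atoms R → p ∈ atoms S
atoms⊆ S {p = p} (only ∷ onlys) p∈ with ∈-++⁻ _ p∈
... | inj₁ p∈c = only p p∈c
... | inj₂ p∈R = atoms⊆ S onlys p∈R

Canon-++⁻ : ∀ S {R V} → All (OnlySymbolsOf S) R → Canon (S ++ R) V → Canon S V
Canon-++⁻ S {R} only canon p Vp
  with ∈-++⁻ (atoms S) (subst (p ∈_) (concatMap-++ atomsClause S R) (canon p Vp))
... | inj₁ p∈S = p∈S
... | inj₂ p∈R = atoms⊆ S only p∈R

evAt-nonSometime : ∀ {R} V l → All NonSometime R → evAt R V l ≡ false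
evAt-nonSometime V l []                 = refl
evAt-nonSometime V l (initial _ ∷ nonS) = evAt-nonSometime V l nonS
evAt-nonSometime V l (step _ _ ∷ nonS)  = evAt-nonSometime V l nonS

evAt-++-false : ∀ S R V l → evAt R V l ≡ false → evAt (S ++ R) V l ≡ evAt S V l
evAt-++-false S R V l evR = begin
  foldr _∨_ false (map t (S ++ R))           ≡⟨ cong (foldr _∨_ false) (map-++ t S R) ⟩
  foldr _∨_ false (map t S ++ map t R)       ≡⟨ foldr-++ _∨_ false (map t S) (map t R) ⟩
  foldr _∨_ (evAt R V l) (map t S)           ≡⟨ cong (λ b → foldr _∨_ b (map t S)) evR ⟩
  foldr _∨_ false (map t S)                  ∎
  where
  open ≡-Reasoning
  t : Clause → Bool
  t = triggers V l

sometime∈-++⁻ : ∀ {S R ks l} → All NonSometime R → sometime ks l ∈ S ++ R → sometime ks l ∈ S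
sometime∈-++⁻ {S} nonS m with ∈-++⁻ S m
... | inj₁ m∈S = m∈S
... | inj₂ m∈R with All.lookup nonS m∈R
...   | ()

module _ {S R : ClauseSet} (only : All (OnlySymbolsOf S) R) (nonS : All NonSometime R) where

  evAt-++ : ∀ V l → evAt (S ++ R) V l ≡ evAt S V l
  evAt-++ V l = evAt-++-false S R V l (evAt-nonSometime V l nonS)

  Initial-++⁻ : ∀ {n} → Initial (S ++ R) n → Initial S n
  Initial-++⁻ {V , _} (canon , sat , ev) =
    Canon-++⁻ S only canon , (λ ls m → sat ls (∈-++⁺ˡ m)) , (λ l → trans (ev l) (evAt-++ V l))

  IsNode-++⁻ : ∀ {n} → IsNode (S ++ R) n → IsNode S n
  IsNode-++⁻ (canon , evLit) =
    Canon-++⁻ S only canon , λ l El → let (ks , m) = evLit l El in ks , sometime∈-++⁻ nonS m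

  Edge-++⁻ : ∀ {n m} → Edge (S ++ R) n m → Edge S n m
  Edge-++⁻ {_} {V' , _} (canon , sat , ev) =
    Canon-++⁻ S only canon , (λ ks ls m → sat ks ls (∈-++⁺ˡ m)) ,
    (λ l → trans (ev l) (cong (_ ∨_) (evAt-++ V' l)))

  Reach-++⁻ : ∀ {n} → Reach (S ++ R) n → Reach S n
  Reach-++⁻ (init i)          = init (Initial-++⁻ i)
  Reach-++⁻ (next r node edge) = next (Reach-++⁻ r) (IsNode-++⁻ node) (Edge-++⁻ edge)

  BehaviourGraph-++ : Subgraph (BehaviourGraph (S ++ R)) (BehaviourGraph S)
  BehaviourGraph-++ = record
    { nodes⊆ = λ _ → Reach-++⁻
    ; edges⊆ = λ _ _ (rn , rm , e) → Reach-++⁻ rn , Reach-++⁻ rm , Edge-++⁻ e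
    ; inits⊆ = λ _ → Initial-++⁻
    }

lemma7 : (S : ClauseSet) (is : List (List Lit)) (ss : List (List Lit × List Lit)) →
         All (OnlySymbolsOf S) (map initial is) →
         All (OnlySymbolsOf S) (map (uncurry step) ss) →
         Subgraph (BehaviourGraph (extend S is ss)) (BehaviourGraph S)
lemma7 S is ss onlyI onlyS = BehaviourGraph-++ (++⁺ onlyI onlyS) (++⁺ initials steps)
  where
  initials : All NonSometime (map initial is)
  initials = map⁺ (universal initial is)

  steps : All NonSometime (map (uncurry step) ss)
  steps = map⁺ (universal (uncurry step) ss)
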